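{- There exists a $\lambda$-term containing two constants, each denoting a strongly polynomial-time computable functional, that evaluates to the limited recursion functional $\mathcal R$.
   Context: Strings over $\{0,1\}$; $\mathbf x^{\le n}$ truncates $\mathbf x$ to its first $n$ symbols; $\mathbf ci$ is $\mathbf c$ followed by bit $i$. $\mathcal R(\varphi,\mathbf a,\mathbf b,\epsilon)=\mathbf a$, $\mathcal R(\varphi,\mathbf a,\mathbf b,\mathbf ci)=\varphi(\mathbf ci,\mathcal R(\varphi,\mathbf a,\mathbf b,\mathbf c))^{\le|\mathbf b|}$. A type-two functional (taking string functions and strings as arguments, possibly several of each) is strongly polynomial-time computable if it is computed by an oracle machine (with one oracle per function argument; an oracle call costs one step) that has a polynomial step-count — a polynomial $p$ with running time at most $p(m)$, where $m$ is the maximum of the input lengths and all oracle-answer lengths in the run — and finite length revision — some $r$ such that in every run at most $r$ times an oracle answer is longer than the inputs and all previous oracle answers. $\lambda$-terms are simply-typed terms over base type of strings with constants for given functionals, abstraction and application. -}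

module Defs where

open import Data.Bool using (Bool; true; false)
open import Data.List using (List; []; _∷_; length; take; reverse)
open import Data.Nat using (ℕ; zero; suc; _+_; _*_; _≤_; _<_; _⊔_; _<ᵇ_)
open import Data.Fin using (Fin)
open import Data.Vec using (Vec; lookup; updateAt; replicate)
import Data.Vec as V
open import Data.Maybe using (Maybe; just; nothing)
open import Data.Product using (_×_; _,_; proj₁; proj₂; Σ; ∃)
open import Data.Unit using (⊤; tt)
open import Relation.Binary.PropositionalEquality using (_≡_)

Str : Set
Str = List Bool

trunc : Str → ℕ → Str
trunc x n = take n x

data _∋_ {A : Set} : List A → A → Set where
  here  : ∀ {x xs} → (x ∷ xs) ∋ x
  there : ∀ {x y xs} → xs ∋ x → (y ∷ xs) ∋ x

infixr 5 _⇒_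
data Ty : Set where
  ι   : Ty
  _⇒_ : Ty → Ty → Ty

⟦_⟧ : Ty → Set
⟦ ι ⟧     = Str
⟦ A ⇒ B ⟧ = ⟦ A ⟧ → ⟦ B ⟧

-- Type-two types: a list of argument kinds (string, or string function
-- of arity suc n), with result a string.

data Kind : Set where
  str : Kind
  fun : ℕ → Kind        -- fun n : a string function of (suc n) string arguments

arrowTy : ℕ → Ty
arrowTy zero    = ι ⇒ ι
arrowTy (suc n) = ι ⇒ arrowTy n

kindTy : Kind → Ty
kindTy str     = ι
kindTy (fun n) = arrowTy n

funTy : List Kind → Ty
funTy []       = ι
funTy (k ∷ ks) = kindTy k ⇒ funTy ks

Env : List Kind → Set
Env []       = ⊤
Env (k ∷ ks) = ⟦ kindTy k ⟧ × Env ks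

apply : ∀ {ks} → ⟦ funTy ks ⟧ → Env ks → Str
apply {[]}     F tt       = F
apply {k ∷ ks} F (x , xs) = apply {ks} (F x) xs

lookupEnv : ∀ {ks k} → Env ks → ks ∋ k → ⟦ kindTy k ⟧
lookupEnv (x , _)  here      = x
lookupEnv (_ , xs) (there i) = lookupEnv xs i

applyFun : ∀ n → ⟦ arrowTy n ⟧ → Vec Str (suc n) → Str
applyFun zero    f (x V.∷ V.[]) = f x
applyFun (suc n) f (x V.∷ xs)   = applyFun n (f x) xs

inputSize : ∀ {ks} → Env ks → ℕ
inputSize {[]}          tt       = 0
inputSize {str ∷ ks}    (x , xs) = length x ⊔ inputSize {ks} xs
inputSize {fun _ ∷ ks}  (_ , xs) = inputSize {ks} xs

-- Oracle machines: string register machines with one oracle per function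
-- argument.  Every instruction (including an oracle call) costs one step.

Label : ℕ → Set
Label L = Maybe (Fin L)          -- nothing = halt

data Instr (ks : List Kind) (R L : ℕ) : Set where
  push : Bool → Fin R → Label L → Instr ks R L
  pop  : Fin R → Label L → Instr ks R L
  case : Fin R → (ifEmpty if0 if1 : Label L) → Instr ks R L
  load : ks ∋ str → Fin R → Label L → Instr ks R L
  call : ∀ {n} → ks ∋ fun n → Vec (Fin R) (suc n) → Fin R → Label L
       → Instr ks R L

record Machine (ks : List Kind) : Set where
  field
    regs  : ℕ                    -- registers are Fin (suc regs); register 0 is output
    len   : ℕ
    prog  : Fin len → Instr ks (suc regs) len
    start : Label len

Config : ∀ {ks} → Machine ks → Set
Config M = Label (Machine.len M) × Vec Str (suc (Machine.regs M))

initial : ∀ {ks} (M : Machine ks) → Config M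
initial M = Machine.start M , replicate _ []

step : ∀ {ks} (M : Machine ks) → Env ks → Config M → Config M × Maybe Str
step M env (nothing , rs) = (nothing , rs) , nothing
step M env (just pc , rs) with Machine.prog M pc
... | push b r l = (l , updateAt rs r (b ∷_)) , nothing
... | pop r l = (l , updateAt rs r tl) , nothing
  where tl : Str → Str
        tl []       = []
        tl (_ ∷ xs) = xs
... | case r l₀ l₁ l₂ with lookup rs r
...   | []        = (l₀ , rs) , nothing
...   | false ∷ _ = (l₁ , rs) , nothing
...   | true ∷ _  = (l₂ , rs) , nothing
step M env (just pc , rs) | load i r l = (l , updateAt rs r (λ _ → lookupEnv env i)) , nothing
step M env (just pc , rs) | call {n} j qs r l =
  let ans = applyFun n (lookupEnv env j) (V.map (lookup rs) qs)
  in (l , updateAt rs r (λ _ → ans)) , just ans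

-- configuration after t steps, together with all oracle answers so far
-- (in reverse chronological order)
run : ∀ {ks} (M : Machine ks) → Env ks → ℕ → Config M × List Str
run M env zero    = initial M , []
run M env (suc t) with run M env t
... | c , as with step M env c
...   | c' , nothing  = c' , as
...   | c' , just a   = c' , (a ∷ as)

halted : ∀ {ks} {M : Machine ks} → Config M → Set
halted (pc , _) = pc ≡ nothing

output : ∀ {ks} {M : Machine ks} → Config M → Str
output (_ , rs) = lookup rs Fin.zero
  where import Data.Fin as Fin

maxLen : ℕ → List Str → ℕ
maxLen m []       = m
maxLen m (a ∷ as) = length a ⊔ maxLen m as

-- number of length revisions; answers given in chronological order
revisionsFrom : ℕ → List Str → ℕ
revisionsFrom cur []       = 0
revisionsFrom cur (a ∷ as) with cur <ᵇ length a
... | true  = suc (revisionsFrom (length a) as)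
... | false = revisionsFrom cur as

revisions : ∀ {ks} → Env ks → List Str → ℕ
revisions env asRev = revisionsFrom (inputSize env) (reverse asRev)

data Poly : Set where
  cst  : ℕ → Poly
  var  : Poly
  _⊕_  : Poly → Poly → Poly
  _⊗_  : Poly → Poly → Poly

evalP : Poly → ℕ → ℕ
evalP (cst c) m = c
evalP var     m = m
evalP (p ⊕ q) m = evalP p m + evalP q m
evalP (p ⊗ q) m = evalP p m * evalP q m

Computes : ∀ {ks} → Machine ks → ⟦ funTy ks ⟧ → Set
Computes {ks} M F = ∀ (env : Env ks) → ∃ λ t →
  halted {M = M} (proj₁ (run M env t)) × output {M = M} (proj₁ (run M env t)) ≡ apply F env

PolynomialStepCount : ∀ {ks} → Machine ks → Set
PolynomialStepCount {ks} M = ∃ λ (p : Poly) → ∀ (env : Env ks) → ∃ λ t →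
  halted {M = M} (proj₁ (run M env t)) ×
  t ≤ evalP p (maxLen (inputSize env) (proj₂ (run M env t)))

FiniteLengthRevision : ∀ {ks} → Machine ks → Set
FiniteLengthRevision {ks} M = ∃ λ (r : ℕ) → ∀ (env : Env ks) (t : ℕ) →
  revisions env (proj₂ (run M env t)) ≤ r

StronglyPolytime : ∀ {ks} → ⟦ funTy ks ⟧ → Set
StronglyPolytime {ks} F = Σ (Machine ks) λ M →
  Computes M F × PolynomialStepCount M × FiniteLengthRevision M

data Tm (C : List Ty) (Γ : List Ty) : Ty → Set where
  con : ∀ {A} → C ∋ A → Tm C Γ A
  var : ∀ {A} → Γ ∋ A → Tm C Γ A
  lam : ∀ {A B} → Tm C (A ∷ Γ) B → Tm C Γ (A ⇒ B)
  app : ∀ {A B} → Tm C Γ (A ⇒ B) → Tm C Γ A → Tm C Γ B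

Vals : List Ty → Set
Vals []       = ⊤
Vals (A ∷ As) = ⟦ A ⟧ × Vals As

lookupVal : ∀ {As A} → Vals As → As ∋ A → ⟦ A ⟧
lookupVal (x , _)  here      = x
lookupVal (_ , xs) (there i) = lookupVal xs i

eval : ∀ {C Γ A} → Tm C Γ A → Vals C → Vals Γ → ⟦ A ⟧
eval (con i)   κ ρ = lookupVal κ i
eval (var i)   κ ρ = lookupVal ρ i
eval (lam t)   κ ρ = λ x → eval t κ (x , ρ)
eval (app t u) κ ρ = eval t κ ρ (eval u κ ρ)

RTy : Ty
RTy = (ι ⇒ ι ⇒ ι) ⇒ ι ⇒ ι ⇒ ι ⇒ ι

-- recursion on the reversed recursion string: (i ∷ rc) encodes c i with c = reverse rc
Rrev : (Str → Str → Str) → Str → Str → List Bool → Str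
Rrev φ a b []        = a
Rrev φ a b (i ∷ rc)  = trunc (φ (reverse (i ∷ rc)) (Rrev φ a b rc)) (length b)

limRec : ⟦ RTy ⟧
limRec φ a b c = Rrev φ a b (reverse c)

module Submission where

-- R φ a b c arises as F₂ (λ p y → F₁ φ p y b) a b c.  Here F₁ φ p y b truncates the
-- single oracle answer φ (reverse p) y to |b|, and F₂ ψ a b c feeds the bits of c one
-- by one to ψ, starting from a, but stops as soon as an answer is longer than b.  F₁ has at most one length revision, as it queries
-- its oracle once; F₂ at most two, as every answer before its last round fits within
-- |b|, which is at most the input size.  The argument built from F₁ never answers
-- longer than b, so F₂ never stops early and computes R.

open import Defs
open import Data.Bool using (Bool; true; false; T; if_then_else_)
open import Data.Empty using (⊥-elim)
open import Data.Fin as Fin using (#_)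
open import Data.List using (List; []; _∷_; length; take; reverse; _++_; _ʳ++_)
open import Data.List.Properties
  using (++-assoc; ++-identityʳ; ++-ʳ++; length-reverse; length-take; reverse-++; reverse-involutive)
open import Data.List.Relation.Unary.All as All using (All; []; _∷_)
open import Data.List.Relation.Unary.All.Properties using (++⁺)
open import Data.Maybe using (just; nothing)
open import Data.Nat using (ℕ; zero; suc; _+_; _*_; _≤_; _<ᵇ_; z≤n; s≤s)
open import Data.Nat.Properties
open import Data.Nat.Tactic.RingSolver using (solve-∀)
open import Data.Product using (Σ; ∃; _×_; _,_; proj₁; proj₂)
open import Data.Unit using (tt)
open import Data.Vec as Vec using (Vec; _∷_; [])
open import Relation.Binary.PropositionalEquality

module Execution {ks : List Kind} (M : Machine ks) (env : Env ks) where

  State : Set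
  State = Config M × List Str

  initialState : State
  initialState = initial M , []

  next : State → State
  next (c , as) with step M env c
  ... | c′ , nothing = c′ , as
  ... | c′ , just a  = c′ , a ∷ as

  exec : State → ℕ → State
  exec x zero    = x
  exec x (suc n) = exec (next x) n

  exec-suc : ∀ x n → exec x (suc n) ≡ next (exec x n)
  exec-suc x zero    = refl
  exec-suc x (suc n) = exec-suc (next x) n

  exec-+ : ∀ x m n → exec x (m + n) ≡ exec (exec x m) n
  exec-+ x zero    n = refl
  exec-+ x (suc m) n = exec-+ (next x) m n

  exec-halted : ∀ rs as n → exec ((nothing , rs) , as) n ≡ ((nothing , rs) , as)
  exec-halted rs as zero    = refl
  exec-halted rs as (suc n) = exec-halted rs as n

  run-suc : ∀ t → run M env (suc t) ≡ next (run M env t)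
  run-suc t with run M env t
  ... | c , as with step M env c
  ...   | c′ , nothing = refl
  ...   | c′ , just a  = refl

  run≡exec : ∀ t → run M env t ≡ exec initialState t
  run≡exec zero    = refl
  run≡exec (suc t) =
    trans (run-suc t) (trans (cong next (run≡exec t)) (sym (exec-suc initialState t)))

  next-extends-answers : ∀ x → ∃ λ ys → proj₂ (next x) ≡ ys ++ proj₂ x
  next-extends-answers (c , as) with step M env c
  ... | c′ , nothing = [] , refl
  ... | c′ , just a  = a ∷ [] , refl

  exec-extends-answers : ∀ x n → ∃ λ ys → proj₂ (exec x n) ≡ ys ++ proj₂ x
  exec-extends-answers x zero = [] , refl
  exec-extends-answers x (suc n) with next-extends-answers x | exec-extends-answers (next x) n
  ... | ys , eq | zs , eq′ =
    zs ++ ys , trans eq′ (trans (cong (zs ++_) eq) (sym (++-assoc zs ys (proj₂ x))))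

  final-extends-answers : ∀ {T rs ans} → exec initialState T ≡ ((nothing , rs) , ans) →
                          ∀ t → ∃ λ ys → ans ≡ ys ++ proj₂ (exec initialState t)
  final-extends-answers {T} {rs} {ans} halts t with exec-extends-answers (exec initialState t) T
  ... | ys , eq = ys , trans (sym (cong proj₂ after)) eq
    where
    open ≡-Reasoning
    after : exec (exec initialState t) T ≡ ((nothing , rs) , ans)
    after = begin
      exec (exec initialState t) T   ≡⟨ sym (exec-+ initialState t T) ⟩
      exec initialState (t + T)      ≡⟨ cong (exec initialState) (+-comm t T) ⟩
      exec initialState (T + t)      ≡⟨ exec-+ initialState T t ⟩
      exec (exec initialState T) t   ≡⟨ cong (λ x → exec x t) halts ⟩
      exec ((nothing , rs) , ans) t  ≡⟨ exec-halted rs ans t ⟩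
      ((nothing , rs) , ans)         ∎

Short : ℕ → Str → Set
Short n a = length a ≤ n

revisionsFrom-++-mono : ∀ cur xs ys → revisionsFrom cur xs ≤ revisionsFrom cur (xs ++ ys)
revisionsFrom-++-mono cur []       ys = z≤n
revisionsFrom-++-mono cur (a ∷ xs) ys with cur <ᵇ length a
... | true  = s≤s (revisionsFrom-++-mono (length a) xs ys)
... | false = revisionsFrom-++-mono cur xs ys

revisionsFrom≤length : ∀ cur xs → revisionsFrom cur xs ≤ length xs
revisionsFrom≤length cur []       = z≤n
revisionsFrom≤length cur (a ∷ xs) with cur <ᵇ length a
... | true  = s≤s (revisionsFrom≤length (length a) xs)
... | false = m≤n⇒m≤1+n (revisionsFrom≤length cur xs)

revisionsFrom-short-∷ : ∀ {cur} a xs → Short cur a →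
                        revisionsFrom cur (a ∷ xs) ≡ revisionsFrom cur xs
revisionsFrom-short-∷ {cur} a xs a≤cur with cur <ᵇ length a in eq
... | true  = ⊥-elim (<⇒≱ (<ᵇ⇒< cur (length a) (subst T (sym eq) tt)) a≤cur)
... | false = refl

revisionsFrom-short-ʳ++ : ∀ {cur} ws xs → All (Short cur) ws →
                          revisionsFrom cur (ws ʳ++ xs) ≡ revisionsFrom cur xs
revisionsFrom-short-ʳ++ []       xs []         = refl
revisionsFrom-short-ʳ++ (w ∷ ws) xs (w≤ ∷ ws≤) =
  trans (revisionsFrom-short-ʳ++ ws (w ∷ xs) ws≤) (revisionsFrom-short-∷ w xs w≤)

-- Answer lists are newest first, as in run: only the k newest answers may be long.
FewLong : ℕ → ℕ → List Str → Set
FewLong k n ys = Σ (List Str) λ zs → Σ (List Str) λ ws →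
  ys ≡ zs ++ ws × length zs ≤ k × All (Short n) ws

FewLong-revisions : ∀ {k n} ys → FewLong k n ys → revisionsFrom n (reverse ys) ≤ k
FewLong-revisions {k} {n} _ (zs , ws , refl , zs≤k , short) = begin
  revisionsFrom n ((zs ++ ws) ʳ++ [])     ≡⟨ cong (revisionsFrom n) (++-ʳ++ zs) ⟩
  revisionsFrom n (ws ʳ++ reverse zs)     ≡⟨ revisionsFrom-short-ʳ++ ws (reverse zs) short ⟩
  revisionsFrom n (reverse zs)            ≤⟨ revisionsFrom≤length n (reverse zs) ⟩
  length (reverse zs)                     ≡⟨ length-reverse zs ⟩
  length zs                               ≤⟨ zs≤k ⟩
  k                                       ∎
  where open ≤-Reasoning

FewLong-mono : ∀ {k m n} ys → m ≤ n → FewLong k m ys → FewLong k n ys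
FewLong-mono _ m≤n (zs , ws , eq , zs≤k , short) =
  zs , ws , eq , zs≤k , All.map (λ a≤m → ≤-trans a≤m m≤n) short

evalP-mono : ∀ p {m n} → m ≤ n → evalP p m ≤ evalP p n
evalP-mono (cst c) m≤n = ≤-refl
evalP-mono var     m≤n = m≤n
evalP-mono (p ⊕ q) m≤n = +-mono-≤ (evalP-mono p m≤n) (evalP-mono q m≤n)
evalP-mono (p ⊗ q) m≤n = *-mono-≤ (evalP-mono p m≤n) (evalP-mono q m≤n)

m≤maxLen : ∀ m as → m ≤ maxLen m as
m≤maxLen m []       = ≤-refl
m≤maxLen m (a ∷ as) = ≤-trans (m≤maxLen m as) (m≤n⊔m (length a) (maxLen m as))

record BoundedRun {ks} (M : Machine ks) (env : Env ks) (out : Str) (bound r : ℕ) : Set where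
  constructor boundedRun
  open Execution M env
  field
    time          : ℕ
    registers     : Vec Str (Machine.regs M)
    answers       : List Str
    halts         : exec initialState time ≡ ((nothing , out ∷ registers) , answers)
    time≤bound    : time ≤ bound
    revisions≤r   : revisions env answers ≤ r

stronglyPolytime : ∀ {ks} (M : Machine ks) (F : ⟦ funTy ks ⟧) (p : Poly) (r : ℕ) →
  (∀ env → BoundedRun M env (apply F env) (evalP p (inputSize env)) r) →
  StronglyPolytime F
stronglyPolytime {ks} M F p r bounded = M , computes , polyStep , (r , finiteRevision)
  where
  module _ (env : Env ks) where
    open Execution M env
    open BoundedRun (bounded env)

    halts′ : run M env time ≡ ((nothing , apply F env ∷ registers) , answers)
    halts′ = trans (run≡exec time) halts

    computes : ∃ λ t → halted {M = M} (proj₁ (run M env t)) ×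
                       output {M = M} (proj₁ (run M env t)) ≡ apply F env
    computes = time , cong (λ x → proj₁ (proj₁ x)) halts′
                    , cong (λ x → Vec.lookup (proj₂ (proj₁ x)) Fin.zero) halts′

    steps≤p : ∃ λ t → halted {M = M} (proj₁ (run M env t)) ×
                       t ≤ evalP p (maxLen (inputSize env) (proj₂ (run M env t)))
    steps≤p = time , cong (λ x → proj₁ (proj₁ x)) halts′
             , subst (λ x → time ≤ evalP p (maxLen (inputSize env) (proj₂ x))) (sym halts′)
                 (≤-trans time≤bound (evalP-mono p (m≤maxLen (inputSize env) answers)))

    finiteRevision : ∀ t → revisions env (proj₂ (run M env t)) ≤ r
    finiteRevision t rewrite run≡exec t with final-extends-answers {time} halts t
    ... | ys , answers≡ = begin
      revisionsFrom (inputSize env) (reverse now)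
        ≤⟨ revisionsFrom-++-mono (inputSize env) (reverse now) (reverse ys) ⟩
      revisionsFrom (inputSize env) (reverse now ++ reverse ys)
        ≡⟨ cong (revisionsFrom (inputSize env)) (sym (reverse-++ ys now)) ⟩
      revisions env (ys ++ now)
        ≡⟨ cong (revisions env) (sym answers≡) ⟩
      revisions env answers
        ≤⟨ revisions≤r ⟩
      r ∎
      where
      open ≤-Reasoning
      now = proj₂ (exec initialState t)

  polyStep : PolynomialStepCount M
  polyStep = p , steps≤p

κ : List Kind
κ = fun 1 ∷ str ∷ str ∷ str ∷ []

truncStep : ⟦ funTy κ ⟧
truncStep φ p y b = trunc (φ (reverse p) y) (length b)

-- r₁ := reverse p (labels 0–4); r₃ := φ r₁ y (5–6); r₅ := the first |b| bits of r₃,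
-- reversed, counted down on a copy r₄ of b (7–12, 14); r₀ := reverse r₅ (13, 15–17).
truncStepProgram : Vec (Instr κ 6 18) 18
truncStepProgram =
  load (there here) (# 2) (just (# 1)) ∷                 -- 0
  case (# 2) (just (# 5)) (just (# 2)) (just (# 4)) ∷    -- 1
  push false (# 1) (just (# 3)) ∷                        -- 2
  pop (# 2) (just (# 1)) ∷                               -- 3
  push true (# 1) (just (# 3)) ∷                         -- 4
  load (there (there here)) (# 2) (just (# 6)) ∷         -- 5
  call here (# 1 ∷ # 2 ∷ []) (# 3) (just (# 7)) ∷        -- 6
  load (there (there (there here))) (# 4) (just (# 8)) ∷ -- 7
  case (# 4) (just (# 13)) (just (# 9)) (just (# 9)) ∷   -- 8
  case (# 3) (just (# 13)) (just (# 10)) (just (# 11)) ∷ -- 9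
  push false (# 5) (just (# 12)) ∷                       -- 10
  push true (# 5) (just (# 12)) ∷                        -- 11
  pop (# 3) (just (# 14)) ∷                              -- 12
  case (# 5) nothing (just (# 15)) (just (# 16)) ∷       -- 13
  pop (# 4) (just (# 8)) ∷                               -- 14
  push false (# 0) (just (# 17)) ∷                       -- 15
  push true (# 0) (just (# 17)) ∷                        -- 16
  pop (# 5) (just (# 13)) ∷                              -- 17
  []

truncStepMachine : Machine κ
truncStepMachine = record
  { regs = 5 ; len = 18 ; prog = Vec.lookup truncStepProgram ; start = just (# 0) }

reverseSteps : Str → ℕ
reverseSteps []      = 1
reverseSteps (_ ∷ s) = 3 + reverseSteps s

copySteps : Str → Str → ℕ
copySteps a       []      = 1
copySteps []      (_ ∷ b) = 2
copySteps (_ ∷ a) (_ ∷ b) = 5 + copySteps a b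

module TruncStepRun (φ : Str → Str → Str) (p y b : Str) where
  open Execution truncStepMachine (φ , p , y , b , tt)

  reverse-loop : ∀ s q r₀ r₃ r₄ r₅ as →
    exec ((just (# 1) , r₀ ∷ q ∷ s ∷ r₃ ∷ r₄ ∷ r₅ ∷ []) , as) (reverseSteps s)
      ≡ ((just (# 5) , r₀ ∷ (s ʳ++ q) ∷ [] ∷ r₃ ∷ r₄ ∷ r₅ ∷ []) , as)
  reverse-loop []          q = λ _ _ _ _ _ → refl
  reverse-loop (false ∷ s) q = reverse-loop s (false ∷ q)
  reverse-loop (true ∷ s)  q = reverse-loop s (true ∷ q)

  copy-loop : ∀ a c acc r₀ r₁ r₂ as → ∃ λ a′ → ∃ λ c′ →
    exec ((just (# 8) , r₀ ∷ r₁ ∷ r₂ ∷ a ∷ c ∷ acc ∷ []) , as) (copySteps a c)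
      ≡ ((just (# 13) , r₀ ∷ r₁ ∷ r₂ ∷ a′ ∷ c′ ∷ (take (length c) a ʳ++ acc) ∷ []) , as)
  copy-loop a           []          acc r₀ r₁ r₂ as = a , [] , refl
  copy-loop []          (false ∷ c) acc r₀ r₁ r₂ as = [] , _ , refl
  copy-loop []          (true ∷ c)  acc r₀ r₁ r₂ as = [] , _ , refl
  copy-loop (false ∷ a) (false ∷ c) acc = copy-loop a c (false ∷ acc)
  copy-loop (false ∷ a) (true ∷ c)  acc = copy-loop a c (false ∷ acc)
  copy-loop (true ∷ a)  (false ∷ c) acc = copy-loop a c (true ∷ acc)
  copy-loop (true ∷ a)  (true ∷ c)  acc = copy-loop a c (true ∷ acc)

  drain-loop : ∀ s q r₁ r₂ r₃ r₄ as →
    exec ((just (# 13) , q ∷ r₁ ∷ r₂ ∷ r₃ ∷ r₄ ∷ s ∷ []) , as) (reverseSteps s)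
      ≡ ((nothing , (s ʳ++ q) ∷ r₁ ∷ r₂ ∷ r₃ ∷ r₄ ∷ [] ∷ []) , as)
  drain-loop []          q = λ _ _ _ _ _ → refl
  drain-loop (false ∷ s) q = drain-loop s (false ∷ q)
  drain-loop (true ∷ s)  q = drain-loop s (true ∷ q)

  answer : Str
  answer = φ (reverse p) y

  prefix : Str
  prefix = take (length b) answer

  drainSteps : ℕ
  drainSteps = reverseSteps (reverse prefix)

  time : ℕ
  time = 1 + (reverseSteps p + (3 + (copySteps answer b + drainSteps)))

  halts : Σ (Vec Str 5) λ rest →
    exec initialState time ≡ ((nothing , prefix ∷ rest) , answer ∷ [])
  halts with copy-loop answer b [] [] (reverse p) y (answer ∷ [])
  ... | a′ , c′ , copied = registers , (begin
      exec initialState time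
        ≡⟨ exec-+ reversing (reverseSteps p) afterReversal ⟩
      exec (exec reversing (reverseSteps p)) afterReversal
        ≡⟨ cong (λ x → exec x afterReversal) (reverse-loop p [] [] [] [] [] []) ⟩
      exec copying (copySteps answer b + drainSteps)
        ≡⟨ exec-+ copying (copySteps answer b) drainSteps ⟩
      exec (exec copying (copySteps answer b)) drainSteps
        ≡⟨ cong (λ x → exec x drainSteps) copied ⟩
      exec draining drainSteps
        ≡⟨ drain-loop (reverse prefix) [] (reverse p) y a′ c′ (answer ∷ []) ⟩
      ((nothing , reverse (reverse prefix) ∷ registers) , answer ∷ [])
        ≡⟨ cong (λ out → (nothing , out ∷ registers) , answer ∷ []) (reverse-involutive prefix) ⟩
      ((nothing , prefix ∷ registers) , answer ∷ []) ∎)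
    where
    open ≡-Reasoning
    afterReversal = 3 + (copySteps answer b + drainSteps)
    registers : Vec Str 5
    registers = reverse p ∷ y ∷ a′ ∷ c′ ∷ [] ∷ []
    reversing copying draining : State
    reversing = (just (# 1) , [] ∷ [] ∷ p ∷ [] ∷ [] ∷ [] ∷ []) , []
    copying   = (just (# 8) , [] ∷ reverse p ∷ y ∷ answer ∷ b ∷ [] ∷ []) , answer ∷ []
    draining  = (just (# 13) , [] ∷ reverse p ∷ y ∷ a′ ∷ c′ ∷ reverse prefix ∷ []) , answer ∷ []

reverseSteps≡ : ∀ s → reverseSteps s ≡ 3 * length s + 1
reverseSteps≡ []      = refl
reverseSteps≡ (_ ∷ s) = trans (cong (3 +_) (reverseSteps≡ s)) (shift (length s))
  where
  shift : ∀ n → 3 + (3 * n + 1) ≡ 3 * suc n + 1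
  shift = solve-∀

copySteps≤ : ∀ a c → copySteps a c ≤ 5 * length c + 2
copySteps≤ a       []      = s≤s z≤n
copySteps≤ []      c@(_ ∷ _) = m≤n+m 2 (5 * length c)
copySteps≤ (_ ∷ a) (_ ∷ c) =
  ≤-trans (+-monoʳ-≤ 5 (copySteps≤ a c)) (≤-reflexive (shift (length c)))
  where
  shift : ∀ n → 5 + (5 * n + 2) ≡ 5 * suc n + 2
  shift = solve-∀

length-take≤ : ∀ n (s : Str) → length (take n s) ≤ n
length-take≤ n s = ≤-trans (≤-reflexive (length-take n s)) (m⊓n≤m n (length s))

module InputSize (φ : Str → Str → Str) (x y z : Str) where
  m : ℕ
  m = inputSize {κ} (φ , x , y , z , tt)

  x≤m : length x ≤ m
  x≤m = m≤m⊔n (length x) _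

  y≤m : length y ≤ m
  y≤m = ≤-trans (m≤m⊔n (length y) _) (m≤n⊔m (length x) _)

  z≤m : length z ≤ m
  z≤m = ≤-trans (≤-trans (m≤m⊔n (length z) 0) (m≤n⊔m (length y) _)) (m≤n⊔m (length x) _)

truncStepPoly : Poly
truncStepPoly = cst 20 ⊗ (var ⊕ cst 1)

truncStep-boundedRun : ∀ env →
  BoundedRun truncStepMachine env (apply {κ} truncStep env) (evalP truncStepPoly (inputSize {κ} env)) 1
truncStep-boundedRun (φ , p , y , b , tt) =
  boundedRun time (proj₁ halts) (answer ∷ []) (proj₂ halts)
    time≤ (revisionsFrom≤length _ (answer ∷ []))
  where
  open TruncStepRun φ p y b
  open InputSize φ p y b
  open ≤-Reasoning

  reverseSteps≤ : ∀ s → length s ≤ m → reverseSteps s ≤ 3 * m + 1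
  reverseSteps≤ s s≤m =
    ≤-trans (≤-reflexive (reverseSteps≡ s)) (+-monoˡ-≤ 1 (*-monoʳ-≤ 3 s≤m))

  prefix≤m : length (reverse prefix) ≤ m
  prefix≤m = begin
    length (reverse prefix) ≡⟨ length-reverse prefix ⟩
    length prefix           ≤⟨ length-take≤ (length b) answer ⟩
    length b                ≤⟨ z≤m ⟩
    m                       ∎

  linear : ∀ n →
    1 + ((3 * n + 1) + (3 + ((5 * n + 2) + (3 * n + 1)))) + (9 * n + 12) ≡ 20 * (n + 1)
  linear = solve-∀

  time≤ : time ≤ evalP truncStepPoly m
  time≤ = begin
    time
      ≤⟨ +-monoʳ-≤ 1 (+-mono-≤ (reverseSteps≤ p x≤m) (+-monoʳ-≤ 3 (+-mono-≤
           (≤-trans (copySteps≤ answer b) (+-monoˡ-≤ 2 (*-monoʳ-≤ 5 z≤m)))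
           (reverseSteps≤ (reverse prefix) prefix≤m)))) ⟩
    1 + ((3 * m + 1) + (3 + ((5 * m + 2) + (3 * m + 1))))
      ≤⟨ m≤m+n _ (9 * m + 12) ⟩
    1 + ((3 * m + 1) + (3 + ((5 * m + 2) + (3 * m + 1)))) + (9 * m + 12)
      ≡⟨ linear m ⟩
    20 * (m + 1) ∎

truncStep-polytime : StronglyPolytime {κ} truncStep
truncStep-polytime =
  stronglyPolytime truncStepMachine truncStep truncStepPoly 1 truncStep-boundedRun

fits : Str → Str → Bool
fits []      b       = true
fits (_ ∷ y) []      = false
fits (_ ∷ y) (_ ∷ b) = fits y b

fits⇒≤ : ∀ y b → fits y b ≡ true → length y ≤ length b
fits⇒≤ []      b       _     = z≤n
fits⇒≤ (_ ∷ y) (_ ∷ b) fits≡ = s≤s (fits⇒≤ y b fits≡)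

fits-take : ∀ y b → fits (take (length b) y) b ≡ true
fits-take y       []      = refl
fits-take []      (_ ∷ b) = refl
fits-take (_ ∷ y) (_ ∷ b) = fits-take y b

iterateWhileFits : (Str → Str → Str) → Str → Str → Str → Str → Str
iterateWhileFits ψ b y P []      = y
iterateWhileFits ψ b y P (i ∷ c) with fits (ψ (i ∷ P) y) b
... | true  = iterateWhileFits ψ b (ψ (i ∷ P) y) (i ∷ P) c
... | false = ψ (i ∷ P) y

boundedIteration : ⟦ funTy κ ⟧
boundedIteration ψ a b c = iterateWhileFits ψ b a [] c

-- r₀ holds the current value, r₁ the unread suffix of c and r₂ the read prefix,
-- reversed.  The oracle is queried twice per round (6, 7) because the length test of
-- r₃ against a copy r₄ of b (9–12) consumes its copy of the answer.
boundedIterationProgram : Vec (Instr κ 5 13) 13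
boundedIterationProgram =
  load (there here) (# 0) (just (# 1)) ∷                 -- 0
  load (there (there (there here))) (# 1) (just (# 2)) ∷ -- 1
  case (# 1) nothing (just (# 3)) (just (# 4)) ∷         -- 2
  push false (# 2) (just (# 5)) ∷                        -- 3
  push true (# 2) (just (# 5)) ∷                         -- 4
  pop (# 1) (just (# 6)) ∷                               -- 5
  call here (# 2 ∷ # 0 ∷ []) (# 3) (just (# 7)) ∷        -- 6
  call here (# 2 ∷ # 0 ∷ []) (# 0) (just (# 8)) ∷        -- 7
  load (there (there here)) (# 4) (just (# 9)) ∷         -- 8
  case (# 3) (just (# 2)) (just (# 10)) (just (# 10)) ∷  -- 9
  case (# 4) nothing (just (# 11)) (just (# 11)) ∷       -- 10
  pop (# 3) (just (# 12)) ∷                              -- 11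
  pop (# 4) (just (# 9)) ∷                               -- 12
  []

boundedIterationMachine : Machine κ
boundedIterationMachine = record
  { regs = 4 ; len = 13 ; prog = Vec.lookup boundedIterationProgram ; start = just (# 0) }

fitsSteps : Str → Str → ℕ
fitsSteps []      b       = 1
fitsSteps (_ ∷ y) []      = 2
fitsSteps (_ ∷ y) (_ ∷ b) = 4 + fitsSteps y b

iterationSteps : (Str → Str → Str) → Str → Str → Str → Str → ℕ
iterationSteps ψ b y P []      = 1
iterationSteps ψ b y P (i ∷ c) with fits (ψ (i ∷ P) y) b
... | true  = 6 + (fitsSteps (ψ (i ∷ P) y) b + iterationSteps ψ b (ψ (i ∷ P) y) (i ∷ P) c)
... | false = 6 + fitsSteps (ψ (i ∷ P) y) b

afterTest : Str → Str → Label 13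
afterTest y b = if fits y b then just (# 2) else nothing

module BoundedIterationRun (ψ : Str → Str → Str) (a b c : Str) where
  open Execution boundedIterationMachine (ψ , a , b , c , tt)

  fits-loop : ∀ y d r₀ r₁ r₂ as → ∃ λ y′ → ∃ λ d′ →
    exec ((just (# 9) , r₀ ∷ r₁ ∷ r₂ ∷ y ∷ d ∷ []) , as) (fitsSteps y d)
      ≡ ((afterTest y d , r₀ ∷ r₁ ∷ r₂ ∷ y′ ∷ d′ ∷ []) , as)
  fits-loop []          d           r₀ r₁ r₂ as = [] , d , refl
  fits-loop (false ∷ y) []          r₀ r₁ r₂ as = _ , [] , refl
  fits-loop (true ∷ y)  []          r₀ r₁ r₂ as = _ , [] , refl
  fits-loop (false ∷ y) (false ∷ d) = fits-loop y d
  fits-loop (false ∷ y) (true ∷ d)  = fits-loop y d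
  fits-loop (true ∷ y)  (false ∷ d) = fits-loop y d
  fits-loop (true ∷ y)  (true ∷ d)  = fits-loop y d

  round : ∀ i y c P r₃ r₄ as → ∃ λ y′ → ∃ λ d′ →
    exec ((just (# 2) , y ∷ (i ∷ c) ∷ P ∷ r₃ ∷ r₄ ∷ []) , as) (6 + fitsSteps (ψ (i ∷ P) y) b)
      ≡ ((afterTest (ψ (i ∷ P) y) b , ψ (i ∷ P) y ∷ c ∷ (i ∷ P) ∷ y′ ∷ d′ ∷ []) ,
         ψ (i ∷ P) y ∷ ψ (i ∷ P) y ∷ as)
  round false y c P r₃ r₄ as = fits-loop (ψ (false ∷ P) y) b _ c (false ∷ P) _
  round true  y c P r₃ r₄ as = fits-loop (ψ (true ∷ P) y) b _ c (true ∷ P) _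

  main-loop : ∀ c y P r₃ r₄ as → Σ (Vec Str 4) λ rest → Σ (List Str) λ ys →
    exec ((just (# 2) , y ∷ c ∷ P ∷ r₃ ∷ r₄ ∷ []) , as) (iterationSteps ψ b y P c)
      ≡ ((nothing , iterateWhileFits ψ b y P c ∷ rest) , ys ++ as) × FewLong 2 (length b) ys
  main-loop []      y P r₃ r₄ as = _ , [] , refl , [] , [] , refl , z≤n , []
  main-loop (i ∷ c) y P r₃ r₄ as with fits (ψ (i ∷ P) y) b in fits≡ | round i y c P r₃ r₄ as
  ... | false | _ , _ , stopped =
    _ , y₁ ∷ y₁ ∷ [] , stopped , y₁ ∷ y₁ ∷ [] , [] , refl , ≤-refl , []
    where y₁ = ψ (i ∷ P) y
  ... | true | y′ , d′ , continued
    with main-loop c (ψ (i ∷ P) y) (i ∷ P) y′ d′ (ψ (i ∷ P) y ∷ ψ (i ∷ P) y ∷ as)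
  ...   | rest , ys , halts , (zs , ws , refl , zs≤2 , short) =
    rest , ys ++ y₁ ∷ y₁ ∷ [] , halts′ , zs , ws ++ y₁ ∷ y₁ ∷ [] , ++-assoc zs ws _ , zs≤2 ,
    ++⁺ short (y₁≤b ∷ y₁≤b ∷ [])
    where
    open ≡-Reasoning
    y₁ = ψ (i ∷ P) y
    k = iterationSteps ψ b y₁ (i ∷ P) c
    out = iterateWhileFits ψ b y₁ (i ∷ P) c

    y₁≤b : Short (length b) y₁
    y₁≤b = fits⇒≤ y₁ b fits≡

    current : State
    current = (just (# 2) , y ∷ (i ∷ c) ∷ P ∷ r₃ ∷ r₄ ∷ []) , as

    halts′ : exec current (6 + fitsSteps y₁ b + k)
               ≡ ((nothing , out ∷ rest) , (ys ++ y₁ ∷ y₁ ∷ []) ++ as)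
    halts′ = begin
      exec current (6 + fitsSteps y₁ b + k)
        ≡⟨ exec-+ current (6 + fitsSteps y₁ b) k ⟩
      exec (exec current (6 + fitsSteps y₁ b)) k
        ≡⟨ cong (λ x → exec x k) continued ⟩
      exec ((just (# 2) , y₁ ∷ c ∷ (i ∷ P) ∷ y′ ∷ d′ ∷ []) , y₁ ∷ y₁ ∷ as) k
        ≡⟨ halts ⟩
      ((nothing , out ∷ rest) , ys ++ y₁ ∷ y₁ ∷ as)
        ≡⟨ cong (λ as′ → (nothing , out ∷ rest) , as′) (sym (++-assoc ys (y₁ ∷ y₁ ∷ []) as)) ⟩
      ((nothing , out ∷ rest) , (ys ++ y₁ ∷ y₁ ∷ []) ++ as) ∎

fitsSteps≤ : ∀ y b → fitsSteps y b ≤ 4 * length b + 2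
fitsSteps≤ []      b       = ≤-trans (s≤s z≤n) (m≤n+m 2 (4 * length b))
fitsSteps≤ (_ ∷ y) []      = ≤-refl
fitsSteps≤ (_ ∷ y) (_ ∷ b) =
  ≤-trans (+-monoʳ-≤ 4 (fitsSteps≤ y b)) (≤-reflexive (shift (length b)))
  where
  shift : ∀ n → 4 + (4 * n + 2) ≡ 4 * suc n + 2
  shift = solve-∀

iterationSteps≤ : ∀ ψ b y P c →
  iterationSteps ψ b y P c ≤ (4 * length b + 8) * length c + 1
iterationSteps≤ ψ b y P []      = m≤n+m 1 _
iterationSteps≤ ψ b y P (i ∷ c) = begin
  iterationSteps ψ b y P (i ∷ c)
    ≤⟨ unfold ⟩
  6 + (fitsSteps y₁ b + ((4 * length b + 8) * length c + 1))
    ≤⟨ +-monoʳ-≤ 6 (+-monoˡ-≤ _ (fitsSteps≤ y₁ b)) ⟩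
  6 + ((4 * length b + 2) + ((4 * length b + 8) * length c + 1))
    ≡⟨ shift (length b) (length c) ⟩
  (4 * length b + 8) * length (i ∷ c) + 1 ∎
  where
  open ≤-Reasoning
  y₁ = ψ (i ∷ P) y

  unfold : iterationSteps ψ b y P (i ∷ c)
           ≤ 6 + (fitsSteps y₁ b + ((4 * length b + 8) * length c + 1))
  unfold with fits y₁ b
  ... | true  = +-monoʳ-≤ 6 (+-monoʳ-≤ (fitsSteps y₁ b) (iterationSteps≤ ψ b y₁ (i ∷ P) c))
  ... | false = +-monoʳ-≤ 6 (m≤m+n (fitsSteps y₁ b) _)

  shift : ∀ m n → 6 + ((4 * m + 2) + ((4 * m + 8) * n + 1)) ≡ (4 * m + 8) * suc n + 1
  shift = solve-∀

boundedIterationPoly : Poly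
boundedIterationPoly = cst 20 ⊗ ((var ⊕ cst 1) ⊗ (var ⊕ cst 1))

boundedIteration-boundedRun : ∀ env →
  BoundedRun boundedIterationMachine env (apply {κ} boundedIteration env)
             (evalP boundedIterationPoly (inputSize {κ} env)) 2
boundedIteration-boundedRun (ψ , a , b , c , tt)
  with BoundedIterationRun.main-loop ψ a b c c a [] [] [] []
... | rest , ys , halts , fewLong =
  boundedRun (2 + iterationSteps ψ b a [] c) rest ys
    (trans halts (cong (λ as → (nothing , boundedIteration ψ a b c ∷ rest) , as) (++-identityʳ ys)))
    time≤
    (FewLong-revisions ys (FewLong-mono ys y≤m fewLong))
  where
  open InputSize ψ a b c
  open ≤-Reasoning

  quadratic : ∀ n →
    2 + ((4 * n + 8) * n + 1) + (16 * (n * n) + 32 * n + 17) ≡ 20 * ((n + 1) * (n + 1))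
  quadratic = solve-∀

  time≤ : 2 + iterationSteps ψ b a [] c ≤ evalP boundedIterationPoly m
  time≤ = begin
    2 + iterationSteps ψ b a [] c
      ≤⟨ +-monoʳ-≤ 2 (iterationSteps≤ ψ b a [] c) ⟩
    2 + ((4 * length b + 8) * length c + 1)
      ≤⟨ +-monoʳ-≤ 2 (+-monoˡ-≤ 1 (*-mono-≤ (+-monoˡ-≤ 8 (*-monoʳ-≤ 4 y≤m)) z≤m)) ⟩
    2 + ((4 * m + 8) * m + 1)
      ≤⟨ m≤m+n _ (16 * (m * m) + 32 * m + 17) ⟩
    2 + ((4 * m + 8) * m + 1) + (16 * (m * m) + 32 * m + 17)
      ≡⟨ quadratic m ⟩
    20 * ((m + 1) * (m + 1)) ∎

boundedIteration-polytime : StronglyPolytime {κ} boundedIteration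
boundedIteration-polytime =
  stronglyPolytime boundedIterationMachine boundedIteration boundedIterationPoly 2
                   boundedIteration-boundedRun

-- Rrev φ a b (i ∷ P) unfolds to truncStep φ (i ∷ P) (Rrev φ a b P) b, which always fits.
iterateWhileFits-truncStep : ∀ φ a b c P →
  iterateWhileFits (λ p y → truncStep φ p y b) b (Rrev φ a b P) P c ≡ Rrev φ a b (c ʳ++ P)
iterateWhileFits-truncStep φ a b []      P = refl
iterateWhileFits-truncStep φ a b (i ∷ c) P
  with fits (Rrev φ a b (i ∷ P)) b | fits-take (φ (reverse (i ∷ P)) (Rrev φ a b P)) b
... | true | refl = iterateWhileFits-truncStep φ a b c (i ∷ P)

-- λ φ a b c → boundedIteration (λ p y → truncStep φ p y b) a b c
limRecTerm : Tm (funTy κ ∷ funTy κ ∷ []) [] RTy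
limRecTerm = lam (lam (lam (lam
  (app (app (app (app (con (there here))
    (lam (lam (app (app (app (app (con here)
      (var (there (there (there (there (there here)))))))
      (var (there here))) (var here)) (var (there (there (there here))))))))
    (var (there (there here)))) (var (there here))) (var here)))))

mainTheorem8 : Σ (List Kind) λ κ₁ → Σ (List Kind) λ κ₂ →
    Σ ⟦ funTy κ₁ ⟧ λ F₁ → Σ ⟦ funTy κ₂ ⟧ λ F₂ →
      StronglyPolytime {κ₁} F₁ × StronglyPolytime {κ₂} F₂ ×
      Σ (Tm (funTy κ₁ ∷ funTy κ₂ ∷ []) [] RTy) λ t →
        ∀ φ a b c → eval t (F₁ , F₂ , tt) tt φ a b c ≡ limRec φ a b c
mainTheorem8 =
  κ , κ , truncStep , boundedIteration , truncStep-polytime , boundedIteration-polytime ,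
  limRecTerm , λ φ a b c → iterateWhileFits-truncStep φ a b c []
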